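{- For every $n\in\mathbb{N}$, there is no labeled forest $\mathsf{F}$ with $n$ vertices whose chain group $G_{\mathsf{F}}\le S_n$ is a copy of (i.e. is isomorphic to) the dihedral group $D_{2n}$ of order $2n$.
   Context: A forest is a finite acyclic graph; a labeled forest with $n$ vertices has vertex set $[n]$. A path in a graph is a sequence of pairwise distinct vertices $v_1,\dots,v_m$ with $v_i$ adjacent to $v_{i+1}$ for all $i$; it is maximal if it is not strictly contained in another path. The chain group $G_{\mathsf{F}}$ of a labeled forest $\mathsf{F}$ with $n$ vertices is the subgroup of $S_n$ generated by all cycles $(i_1\ \cdots\ i_m)$ such that $i_1,\dots,i_m$ is a maximal path of $\mathsf{F}$ (a one-vertex path gives the identity). $D_{2n}$ denotes the dihedral group of order $2n$ (so $D_2\cong\mathbb{Z}/2\mathbb{Z}$ and $D_4\cong\mathbb{Z}/2\mathbb{Z}\times\mathbb{Z}/2\mathbb{Z}$). -}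

module Defs where

open import Data.Nat using (ℕ; zero; suc; _+_; _∸_; _<_; _≥_)
open import Data.Nat.DivMod using (_mod_)
open import Data.Fin using (Fin; toℕ; _≟_)
open import Data.Bool using (Bool; true; false; _xor_)
open import Data.List using (List; []; _∷_; _++_; length; reverse; last)
open import Data.List.Relation.Unary.Linked using (Linked)
open import Data.List.Relation.Unary.Unique.Propositional using (Unique)
open import Data.Maybe using (just)
open import Data.Product using (Σ; _×_; _,_; ∃; ∃-syntax)
open import Data.Sum using (_⊎_)
open import Data.Empty using (⊥)
open import Data.Unit using (⊤)
open import Relation.Nullary using (¬_; yes; no)
open import Relation.Binary.PropositionalEquality using (_≡_; _≗_)
open import Function using (_∘_; id)

NonEmpty : {A : Set} → List A → Set
NonEmpty []      = ⊥
NonEmpty (_ ∷ _) = ⊤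

record Graph (n : ℕ) : Set where
  field
    adj   : Fin n → Fin n → Bool
    sym   : ∀ i j → adj i j ≡ adj j i
    irrefl : ∀ i → adj i i ≡ false

module _ {n : ℕ} (G : Graph n) where
  open Graph G

  Adj : Fin n → Fin n → Set
  Adj i j = adj i j ≡ true

  IsPath : List (Fin n) → Set
  IsPath p = NonEmpty p × Unique p × Linked Adj p

  IsCycle : List (Fin n) → Set
  IsCycle [] = ⊥
  IsCycle (v ∷ vs) =
    IsPath (v ∷ vs) × length (v ∷ vs) ≥ 3 × Σ (Fin n) (λ w → last (v ∷ vs) ≡ just w × Adj w v)

  Acyclic : Set
  Acyclic = ∀ c → ¬ IsCycle c

  SubPath : List (Fin n) → List (Fin n) → Set
  SubPath p q = ∃[ xs ] ∃[ ys ] (q ≡ xs ++ p ++ ys ⊎ reverse q ≡ xs ++ p ++ ys)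

  IsMaximalPath : List (Fin n) → Set
  IsMaximalPath p =
    IsPath p × (∀ q → IsPath q → SubPath p q → length p < length q → ⊥)

record Forest (n : ℕ) : Set where
  field
    graph   : Graph n
    acyclic : Acyclic graph

-- The cycle (i₁ ⋯ iₘ) as a function Fin n → Fin n:
-- iₖ ↦ iₖ₊₁, iₘ ↦ i₁, every other point fixed.

cycleGo : {n : ℕ} → Fin n → Fin n → List (Fin n) → Fin n → Fin n
cycleGo h a [] x with a ≟ x
... | yes _ = h
... | no  _ = x
cycleGo h a (b ∷ r) x with a ≟ x
... | yes _ = b
... | no  _ = cycleGo h b r x

cycle : {n : ℕ} → List (Fin n) → Fin n → Fin n
cycle [] x = x
cycle (h ∷ t) x = cycleGo h h t x

data InChainGroupW {n : ℕ} (F : Forest n) : (Fin n → Fin n) → Set where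
  one  : InChainGroupW F id
  gen  : ∀ p → IsMaximalPath (Forest.graph F) p → InChainGroupW F (cycle p)
  comp : ∀ {f g} → InChainGroupW F f → InChainGroupW F g → InChainGroupW F (f ∘ g)
  inv  : ∀ {f} g → InChainGroupW F f → (∀ x → f (g x) ≡ x) → InChainGroupW F g

_∈G_ : {n : ℕ} → (Fin n → Fin n) → Forest n → Set
σ ∈G F = ∃[ f ] (InChainGroupW F f × σ ≗ f)

-- Dihedral group D_{2n}: elements r^a s^e with a ∈ ℤ/n, e ∈ {0,1},
-- encoded as (a , e) ∈ Fin n × Bool, with
--   (r^a s^e)(r^b s^f) = r^(a + (-1)^e b) s^(e + f).

Dihedral : ℕ → Set
Dihedral n = Fin n × Bool

addMod : {n : ℕ} → Fin n → Fin n → Fin n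
addMod {suc k} a b = (toℕ a + toℕ b) mod suc k

negMod : {n : ℕ} → Fin n → Fin n
negMod {suc k} a = (suc k ∸ toℕ a) mod suc k

dihMul : {n : ℕ} → Dihedral n → Dihedral n → Dihedral n
dihMul (a , false) (b , f) = addMod a b , f
dihMul (a , true)  (b , f) = addMod a (negMod b) , (true xor f)

ChainGroupIsoDihedral : {n : ℕ} → Forest n → Set
ChainGroupIsoDihedral {n} F =
  Σ (Dihedral n → (Fin n → Fin n)) λ φ →
      (∀ d → φ d ∈G F)
    × (∀ d e → φ (dihMul d e) ≗ (φ d ∘ φ e))
    × (∀ d e → φ d ≗ φ e → d ≡ e)
    × (∀ σ → σ ∈G F → ∃[ d ] (σ ≗ φ d))

-- The case n ≥ 3 rests on one structural fact about chain groups.  A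
-- maximal path of a forest has one, two, or at least three vertices.  A
-- one-vertex path yields the identity.  A maximal edge {u,v} is a whole
-- connected component, so every path lies inside {u,v} or avoids it, and
-- hence every generator commutes with the transposition (u v).  A longer
-- maximal path yields a cycle which is not an involution.  In D_{2n} any
-- two elements commute unless one of them is a reflection, i.e. an
-- involution; so an isomorphism G_F ≅ D_{2n} forces all generators, hence
-- all of G_F, hence D_{2n}, to be abelian, which fails for n ≥ 3.
-- The remaining cases are counting: D_0 is empty while G_F contains the
-- identity, and for n ∈ {1,2} a permutation of [n] is determined by the
-- image of one point, so G_F has at most n < 2n elements.

module Submission where

open import Defs
open import Data.Nat using (ℕ; zero; suc; _+_; _∸_; _≤_; _%_; z≤n; s≤s)
open import Data.Nat.Properties using (m+[n∸m]≡n; <⇒≤; +-comm; 1+n≰n)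
open import Data.Nat.DivMod using (_mod_; m<n⇒m%n≡m; %-distribˡ-+; m%n%n≡m%n; n%n≡0)
open import Data.Fin using (Fin; toℕ; _≟_) renaming (zero to fzero; suc to fsuc)
open import Data.Fin.Properties using (toℕ-injective; toℕ-fromℕ<; toℕ<n; injective⇒≤)
open import Data.Bool using (true; false)
open import Data.List using (List; []; _∷_)
open import Data.List.Relation.Unary.Linked using (Linked; []; [-]; _∷_)
open import Data.List.Relation.Unary.AllPairs using ([]; _∷_)
open import Data.List.Relation.Unary.All as All using (All; []; _∷_)
open import Data.List.Relation.Unary.Any using (any?; here; there)
open import Data.List.Membership.Propositional using (_∈_)
open import Data.Product using (_×_; _,_; proj₁; proj₂; ∃-syntax)
open import Data.Sum using (_⊎_; inj₁; inj₂; [_,_]′)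
open import Data.Empty using (⊥-elim)
open import Relation.Nullary using (¬_; yes; no)
open import Relation.Nullary.Decidable using (_⊎-dec_)
open import Relation.Binary.PropositionalEquality
open import Function using (_∘_; id)
open import Function.Definitions using (Injective)
open import Algebra.Definitions using (Involutive)

Commute : ∀ {n} → (Fin n → Fin n) → (Fin n → Fin n) → Set
Commute σ τ = ∀ x → σ (τ x) ≡ τ (σ x)

Commute-sym : ∀ {n} {σ τ : Fin n → Fin n} → Commute σ τ → Commute τ σ
Commute-sym στ≡τσ x = sym (στ≡τσ x)

identity-commutes : ∀ {n} {σ : Fin n → Fin n} (τ : Fin n → Fin n) → σ ≗ id → Commute σ τ
identity-commutes τ σ≗id x = trans (σ≗id (τ x)) (cong τ (sym (σ≗id x)))

Commute-resp : ∀ {n} {σ σ′ τ τ′ : Fin n → Fin n} → σ ≗ σ′ → τ ≗ τ′ → Commute σ′ τ′ → Commute σ τ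
Commute-resp {σ = σ} {σ′} {τ} {τ′} σ≗σ′ τ≗τ′ commute x = begin
  σ (τ x)   ≡⟨ σ≗σ′ (τ x) ⟩
  σ′ (τ x)  ≡⟨ cong σ′ (τ≗τ′ x) ⟩
  σ′ (τ′ x) ≡⟨ commute x ⟩
  τ′ (σ′ x) ≡⟨ cong τ′ (σ≗σ′ x) ⟨
  τ′ (σ x)  ≡⟨ τ≗τ′ (σ x) ⟨
  τ (σ x)   ∎
  where open ≡-Reasoning

Involutive-resp : ∀ {n} {σ σ′ : Fin n → Fin n} → σ ≗ σ′ → Involutive _≡_ σ′ → Involutive _≡_ σ
Involutive-resp {σ = σ} {σ′} σ≗σ′ involutive x =
  trans (σ≗σ′ (σ x)) (trans (cong σ′ (σ≗σ′ x)) (involutive x))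

toℕ-mod : ∀ {m} (b : Fin (suc m)) → toℕ b mod suc m ≡ b
toℕ-mod b = toℕ-injective (trans (toℕ-fromℕ< _) (m<n⇒m%n≡m (toℕ<n b)))

addMod-comm : ∀ {m} (a b : Fin (suc m)) → addMod a b ≡ addMod b a
addMod-comm {m} a b = cong (_mod suc m) (+-comm (toℕ a) (toℕ b))

addMod-negMod : ∀ {m} (a : Fin (suc m)) → addMod a (negMod a) ≡ fzero
addMod-negMod {m} a = toℕ-injective (begin
    toℕ (addMod a (negMod a))
  ≡⟨ toℕ-fromℕ< _ ⟩
    (toℕ a + toℕ ((N ∸ toℕ a) mod N)) % N
  ≡⟨ cong (λ z → (toℕ a + z) % N) (toℕ-fromℕ< _) ⟩
    (toℕ a + (N ∸ toℕ a) % N) % N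
  ≡⟨ %-distribˡ-+ (toℕ a) ((N ∸ toℕ a) % N) N ⟩
    (toℕ a % N + (N ∸ toℕ a) % N % N) % N
  ≡⟨ cong (λ z → (toℕ a % N + z) % N) (m%n%n≡m%n (N ∸ toℕ a) N) ⟩
    (toℕ a % N + (N ∸ toℕ a) % N) % N
  ≡⟨ %-distribˡ-+ (toℕ a) (N ∸ toℕ a) N ⟨
    (toℕ a + (N ∸ toℕ a)) % N
  ≡⟨ cong (_% N) (m+[n∸m]≡n (<⇒≤ (toℕ<n a))) ⟩
    N % N
  ≡⟨ n%n≡0 N ⟩
    0 ∎)
  where
  open ≡-Reasoning
  N = suc m

identity : ∀ {m} → Dihedral (suc m)
identity = fzero , false

dihMul-identityˡ : ∀ {m} (d : Dihedral (suc m)) → dihMul identity d ≡ d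
dihMul-identityˡ (b , f) = cong (_, f) (toℕ-mod b)

inverse : ∀ {m} → Dihedral (suc m) → Dihedral (suc m)
inverse (a , false) = negMod a , false
inverse (a , true)  = a , true

dihMul-inverseˡ : ∀ {m} (d : Dihedral (suc m)) → dihMul (inverse d) d ≡ identity
dihMul-inverseˡ (a , false) = cong (_, false) (trans (addMod-comm (negMod a) a) (addMod-negMod a))
dihMul-inverseˡ (a , true)  = cong (_, false) (addMod-negMod a)

reflection-square : ∀ {m} (a : Fin (suc m)) → dihMul (a , true) (a , true) ≡ identity
reflection-square a = cong (_, false) (addMod-negMod a)

dihedral-dichotomy : ∀ {m} (d d′ : Dihedral (suc m)) →
  dihMul d d ≡ identity ⊎ dihMul d′ d′ ≡ identity ⊎ dihMul d d′ ≡ dihMul d′ d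
dihedral-dichotomy (a , true)  _          = inj₁ (reflection-square a)
dihedral-dichotomy (a , false) (b , true)  = inj₂ (inj₁ (reflection-square b))
dihedral-dichotomy (a , false) (b , false) = inj₂ (inj₂ (cong (_, false) (addMod-comm a b)))

-- For N ≥ 3 the rotation r and the reflection rs do not commute:
-- r · rs = r²s but rs · r = s.
dihedral-nonabelian : ∀ k →
  dihMul {3 + k} (fsuc fzero , false) (fsuc fzero , true) ≢ dihMul (fsuc fzero , true) (fsuc fzero , false)
dihedral-nonabelian k r·rs≡rs·r with trans r·rs≡rs·r (cong (_, true) (addMod-negMod (fsuc fzero)))
... | ()

cycleGo-here : ∀ {n} (h a b : Fin n) r → cycleGo h a (b ∷ r) a ≡ b
cycleGo-here h a b r with a ≟ a
... | yes _   = refl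
... | no a≢a = ⊥-elim (a≢a refl)

cycleGo-last : ∀ {n} (h a : Fin n) → cycleGo h a [] a ≡ h
cycleGo-last h a with a ≟ a
... | yes _   = refl
... | no a≢a = ⊥-elim (a≢a refl)

cycleGo-later : ∀ {n} (h a b : Fin n) r x → a ≢ x → cycleGo h a (b ∷ r) x ≡ cycleGo h b r x
cycleGo-later h a b r x a≢x with a ≟ x
... | yes a≡x = ⊥-elim (a≢x a≡x)
... | no _    = refl

cycle-outside : ∀ {n} (q : List (Fin n)) x → ¬ x ∈ q → cycle q x ≡ x
cycle-outside []      x _   = refl
cycle-outside (h ∷ t) x x∉q = go h t x∉q
  where
  go : ∀ a r → ¬ x ∈ (a ∷ r) → cycleGo h a r x ≡ x
  go a [] x∉ with a ≟ x
  ... | yes refl = ⊥-elim (x∉ (here refl))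
  ... | no _     = refl
  go a (b ∷ r) x∉ with a ≟ x
  ... | yes refl = ⊥-elim (x∉ (here refl))
  ... | no _     = go b r (x∉ ∘ there)

cycle-inside : ∀ {n} (q : List (Fin n)) x → x ∈ q → cycle q x ∈ q
cycle-inside (h ∷ t) x x∈q = go h t x∈q
  where
  go : ∀ a r → x ∈ (a ∷ r) → cycleGo h a r x ∈ (h ∷ r)
  go a [] x∈ with a ≟ x
  go a [] x∈          | yes _   = here refl
  go a [] (here refl) | no a≢a = ⊥-elim (a≢a refl)
  go a (b ∷ r) x∈ with a ≟ x
  go a (b ∷ r) x∈          | yes _   = there (here refl)
  go a (b ∷ r) (here refl) | no a≢a = ⊥-elim (a≢a refl)
  go a (b ∷ r) (there x∈)  | no _ with go b r x∈
  ... | here eq = here eq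
  ... | there k = there (there k)

cycle-preserves : ∀ {n} (P : Fin n → Set) q → All P q ⊎ All (¬_ ∘ P) q → ∀ x → P x → P (cycle q x)
cycle-preserves P q inside-or-outside x px with any? (x ≟_) q | inside-or-outside
... | no x∉q  | _                = subst P (sym (cycle-outside q x x∉q)) px
... | yes x∈q | inj₁ all-in      = All.lookup all-in (cycle-inside q x x∈q)
... | yes x∈q | inj₂ all-outside = ⊥-elim (All.lookup all-outside x∈q px)

cycle-singleton : ∀ {n} (w : Fin n) → cycle (w ∷ []) ≗ id
cycle-singleton w x with w ≟ x
... | yes w≡x = w≡x
... | no _    = refl

long-cycle-not-involutive : ∀ {n} {a b c : Fin n} {r} → a ≢ b → a ≢ c →
  ¬ Involutive _≡_ (cycle (a ∷ b ∷ c ∷ r))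
long-cycle-not-involutive {n} {a} {b} {c} {r} a≢b a≢c involutive = a≢c (begin
    a                     ≡⟨ involutive a ⟨
    ρ (ρ a)               ≡⟨ cong ρ (cycleGo-here a a b (c ∷ r)) ⟩
    ρ b                   ≡⟨ cycleGo-later a a b (c ∷ r) b a≢b ⟩
    cycleGo a b (c ∷ r) b ≡⟨ cycleGo-here a b c r ⟩
    c                     ∎)
  where
  open ≡-Reasoning
  ρ : Fin n → Fin n
  ρ = cycle (a ∷ b ∷ c ∷ r)

transposition : ∀ {n} → Fin n → Fin n → Fin n → Fin n
transposition u v = cycle (u ∷ v ∷ [])

transposition-u : ∀ {n} (u v : Fin n) → transposition u v u ≡ v
transposition-u u v = cycleGo-here u u v []

transposition-v : ∀ {n} (u v : Fin n) → u ≢ v → transposition u v v ≡ u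
transposition-v u v u≢v = trans (cycleGo-later u u v [] v u≢v) (cycleGo-last u v)

transposition-other : ∀ {n} (u v x : Fin n) → x ≢ u → x ≢ v → transposition u v x ≡ x
transposition-other u v x x≢u x≢v =
  cycle-outside (u ∷ v ∷ []) x λ { (here x≡u) → x≢u x≡u ; (there (here x≡v)) → x≢v x≡v }

fix-or-swap : ∀ {n} {u v : Fin n} (τ : Fin n → Fin n) → u ≢ v → Injective _≡_ _≡_ τ →
  (∀ x → x ≡ u ⊎ x ≡ v → τ x ≡ u ⊎ τ x ≡ v) →
  (τ u ≡ u × τ v ≡ v) ⊎ (τ u ≡ v × τ v ≡ u)
fix-or-swap τ u≢v τ-inj preserves with preserves _ (inj₁ refl) | preserves _ (inj₂ refl)
... | inj₁ τu≡u | inj₁ τv≡u = ⊥-elim (u≢v (τ-inj (trans τu≡u (sym τv≡u))))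
... | inj₁ τu≡u | inj₂ τv≡v = inj₁ (τu≡u , τv≡v)
... | inj₂ τu≡v | inj₁ τv≡u = inj₂ (τu≡v , τv≡u)
... | inj₂ τu≡v | inj₂ τv≡v = ⊥-elim (u≢v (τ-inj (trans τu≡v (sym τv≡v))))

transposition-commutes : ∀ {n} {u v : Fin n} (τ : Fin n → Fin n) → u ≢ v → Injective _≡_ _≡_ τ →
  (∀ x → x ≡ u ⊎ x ≡ v → τ x ≡ u ⊎ τ x ≡ v) →
  (∀ x → ¬ (x ≡ u ⊎ x ≡ v) → ¬ (τ x ≡ u ⊎ τ x ≡ v)) →
  Commute (transposition u v) τ
transposition-commutes {u = u} {v} τ u≢v τ-inj preserves preserves-complement x
  with x ≟ u | x ≟ v | fix-or-swap τ u≢v τ-inj preserves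
... | yes refl | _ | inj₁ (τu≡u , τv≡v) =
  trans (cong (transposition u v) τu≡u)
    (trans (transposition-u u v) (trans (sym τv≡v) (cong τ (sym (transposition-u u v)))))
... | yes refl | _ | inj₂ (τu≡v , τv≡u) =
  trans (cong (transposition u v) τu≡v)
    (trans (transposition-v u v u≢v) (trans (sym τv≡u) (cong τ (sym (transposition-u u v)))))
... | no _ | yes refl | inj₁ (τu≡u , τv≡v) =
  trans (cong (transposition u v) τv≡v)
    (trans (transposition-v u v u≢v) (trans (sym τu≡u) (cong τ (sym (transposition-v u v u≢v)))))
... | no _ | yes refl | inj₂ (τu≡v , τv≡u) =
  trans (cong (transposition u v) τv≡u)
    (trans (transposition-u u v) (trans (sym τu≡v) (cong τ (sym (transposition-v u v u≢v)))))
... | no x≢u | no x≢v | _ =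
  trans (transposition-other u v (τ x) (τx∉ ∘ inj₁) (τx∉ ∘ inj₂))
        (cong τ (sym (transposition-other u v x x≢u x≢v)))
  where
  τx∉ : ¬ (τ x ≡ u ⊎ τ x ≡ v)
  τx∉ = preserves-complement x [ x≢u , x≢v ]′

-- A maximal edge {u,v} of a graph is a connected component: every path
-- lies inside {u,v} or avoids it, so every maximal-path cycle preserves
-- {u,v} and its complement.

module MaximalEdge {n} (G : Graph n) {u v : Fin n} (maximal : IsMaximalPath G (u ∷ v ∷ [])) where

  InEdge : Fin n → Set
  InEdge x = x ≡ u ⊎ x ≡ v

  u≢v : u ≢ v
  u≢v = distinct maximal
    where
    distinct : IsMaximalPath G (u ∷ v ∷ []) → u ≢ v
    distinct ((_ , ((u≢v ∷ []) ∷ _) , _) , _) = u≢v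

  private
    u~v : Adj G u v
    u~v = adjacent maximal
      where
      adjacent : IsMaximalPath G (u ∷ v ∷ []) → Adj G u v
      adjacent ((_ , _ , (u~v ∷ _)) , _) = u~v

    adj-sym : ∀ {a b} → Adj G a b → Adj G b a
    adj-sym {a} {b} a~b = trans (Graph.sym G b a) a~b

  -- A neighbour of u or v is u or v, otherwise the edge would extend.
  edge-closed : ∀ {a b} → Adj G a b → InEdge a → InEdge b
  edge-closed {b = b} a~b _ with b ≟ u | b ≟ v
  ... | yes b≡u | _       = inj₁ b≡u
  ... | no _    | yes b≡v = inj₂ b≡v
  edge-closed {b = b} a~b (inj₁ refl) | no b≢u | no b≢v =
    ⊥-elim (proj₂ maximal (b ∷ u ∷ v ∷ [])
      (_ , ((b≢u ∷ b≢v ∷ []) ∷ (u≢v ∷ []) ∷ [] ∷ []) , (adj-sym a~b ∷ u~v ∷ [-]))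
      (b ∷ [] , [] , inj₁ refl) (s≤s (s≤s (s≤s z≤n))))
  edge-closed {b = b} a~b (inj₂ refl) | no b≢u | no b≢v =
    ⊥-elim (proj₂ maximal (u ∷ v ∷ b ∷ [])
      (_ , ((u≢v ∷ (b≢u ∘ sym) ∷ []) ∷ ((b≢v ∘ sym) ∷ []) ∷ [] ∷ []) , (u~v ∷ a~b ∷ [-]))
      ([] , b ∷ [] , inj₁ refl) (s≤s (s≤s (s≤s z≤n))))

  inside-or-outside : ∀ {q} → Linked (Adj G) q → All InEdge q ⊎ All (¬_ ∘ InEdge) q
  inside-or-outside [] = inj₁ []
  inside-or-outside {x ∷ []} [-] with (x ≟ u) ⊎-dec (x ≟ v)
  ... | yes x∈ = inj₁ (x∈ ∷ [])
  ... | no x∉  = inj₂ (x∉ ∷ [])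
  inside-or-outside (a~b ∷ rest) with inside-or-outside rest
  ... | inj₁ (b∈ ∷ all-in)  = inj₁ (edge-closed (adj-sym a~b) b∈ ∷ b∈ ∷ all-in)
  ... | inj₂ (b∉ ∷ all-out) = inj₂ ((b∉ ∘ edge-closed a~b) ∷ b∉ ∷ all-out)

  path-preserves-edge : ∀ {q} → IsPath G q → ∀ x → InEdge x → InEdge (cycle q x)
  path-preserves-edge {q} (_ , _ , linked) = cycle-preserves InEdge q (inside-or-outside linked)

  path-preserves-complement : ∀ {q} → IsPath G q → ∀ x → ¬ InEdge x → ¬ InEdge (cycle q x)
  path-preserves-complement {q} (_ , _ , linked) =
    cycle-preserves (¬_ ∘ InEdge) q
      ([ inj₂ ∘ All.map (λ x∈ x∉ → x∉ x∈) , inj₁ ]′ (inside-or-outside linked))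

-- Edges commute with all generators (MaximalEdge), singletons give the
-- identity, and longer maximal paths give non-involutions, so all
-- generators commute pairwise, and hence so does all of G_F.

module ChainGroupAbelian {n} (F : Forest n)
  (injective : ∀ {f} → InChainGroupW F f → Injective _≡_ _≡_ f)
  (involution-or-commute : ∀ {σ τ} → InChainGroupW F σ → InChainGroupW F τ →
     Involutive _≡_ σ ⊎ Involutive _≡_ τ ⊎ Commute σ τ) where

  private
    G : Graph n
    G = Forest.graph F

  edge-commutes : ∀ {u v} → IsMaximalPath G (u ∷ v ∷ []) →
    ∀ q → IsMaximalPath G q → Commute (transposition u v) (cycle q)
  edge-commutes edge q maximal-q =
    transposition-commutes (cycle q) u≢v (injective (gen q maximal-q))
      (path-preserves-edge (proj₁ maximal-q)) (path-preserves-complement (proj₁ maximal-q))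
    where open MaximalEdge G edge

  long-not-involutive : ∀ {a b c r} → IsMaximalPath G (a ∷ b ∷ c ∷ r) →
    ¬ Involutive _≡_ (cycle (a ∷ b ∷ c ∷ r))
  long-not-involutive ((_ , ((a≢b ∷ a≢c ∷ _) ∷ _) , _) , _) = long-cycle-not-involutive a≢b a≢c

  generators-commute : ∀ p q → IsMaximalPath G p → IsMaximalPath G q → Commute (cycle p) (cycle q)
  generators-commute [] _ ((() , _) , _) _
  generators-commute (w ∷ []) q _ _ = identity-commutes (cycle q) (cycle-singleton w)
  generators-commute (u ∷ v ∷ []) q edge maximal-q = edge-commutes edge q maximal-q
  generators-commute (_ ∷ _ ∷ _ ∷ _) [] _ ((() , _) , _)
  generators-commute p@(_ ∷ _ ∷ _ ∷ _) (w ∷ []) _ _ =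
    Commute-sym {σ = cycle (w ∷ [])} (identity-commutes (cycle p) (cycle-singleton w))
  generators-commute p@(_ ∷ _ ∷ _ ∷ _) (u ∷ v ∷ []) long edge =
    Commute-sym {σ = transposition u v} (edge-commutes edge p long)
  generators-commute p@(_ ∷ _ ∷ _ ∷ _) q@(_ ∷ _ ∷ _ ∷ _) long-p long-q
    with involution-or-commute (gen p long-p) (gen q long-q)
  ... | inj₁ p-involutive        = ⊥-elim (long-not-involutive long-p p-involutive)
  ... | inj₂ (inj₁ q-involutive) = ⊥-elim (long-not-involutive long-q q-involutive)
  ... | inj₂ (inj₂ commute)      = commute

  commutes-with-G : ∀ h → (∀ p → IsMaximalPath G p → Commute (cycle p) h) →
    ∀ {f} → InChainGroupW F f → Commute f h
  commutes-with-G h commutes one x = refl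
  commutes-with-G h commutes (gen p maximal) = commutes p maximal
  commutes-with-G h commutes (comp {f} {g} wf wg) x =
    trans (cong f (commutes-with-G h commutes wg x)) (commutes-with-G h commutes wf (g x))
  commutes-with-G h commutes (inv {f} g wf f∘g≗id) x = injective wf (begin
    f (g (h x)) ≡⟨ f∘g≗id (h x) ⟩
    h x         ≡⟨ cong h (f∘g≗id x) ⟨
    h (f (g x)) ≡⟨ commutes-with-G h commutes wf (g x) ⟨
    f (h (g x)) ∎)
    where open ≡-Reasoning

  abelian : ∀ {f g} → InChainGroupW F f → InChainGroupW F g → Commute f g
  abelian {g = g} wf wg = commutes-with-G g
    (λ p maximal → Commute-sym {σ = g} (commutes-with-G (cycle p)
      (λ q maximal-q → generators-commute q p maximal-q maximal) wg)) wf

module Isomorphism {m} (F : Forest (suc m)) (φ : Dihedral (suc m) → Fin (suc m) → Fin (suc m))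
  (φ-in-G : ∀ d → φ d ∈G F)
  (φ-hom : ∀ d e → φ (dihMul d e) ≗ (φ d ∘ φ e))
  (φ-injective : ∀ d e → φ d ≗ φ e → d ≡ e)
  (φ-onto : ∀ σ → σ ∈G F → ∃[ d ] (σ ≗ φ d)) where

  -- φ sends the identity of D_{2N} to the identity map; the element of
  -- D_{2N} matching id ∈ G_F is idempotent, hence the identity.
  φ-identity : φ identity ≗ id
  φ-identity x with φ-onto id (id , one , λ _ → refl)
  ... | d , id≗φd = trans (cong (λ e → φ e x) (sym d≡identity)) (sym (id≗φd x))
    where
    d≡identity : d ≡ identity
    d≡identity = trans (sym (dihMul-identityˡ d))
      (φ-injective _ _ λ y → trans (φ-hom identity d y) (cong (φ identity) (sym (id≗φd y))))

  -- Each φ d is undone by φ (d⁻¹), so it is injective, and so is every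
  -- element of G_F.
  φ-retraction : ∀ d x → φ (inverse d) (φ d x) ≡ x
  φ-retraction d x = begin
    φ (inverse d) (φ d x)      ≡⟨ φ-hom (inverse d) d x ⟨
    φ (dihMul (inverse d) d) x ≡⟨ cong (λ e → φ e x) (dihMul-inverseˡ d) ⟩
    φ identity x               ≡⟨ φ-identity x ⟩
    x                          ∎
    where open ≡-Reasoning

  φ-permutation : ∀ d → Injective _≡_ _≡_ (φ d)
  φ-permutation d {x} {y} φdx≡φdy =
    trans (sym (φ-retraction d x)) (trans (cong (φ (inverse d)) φdx≡φdy) (φ-retraction d y))

  G-injective : ∀ {f} → InChainGroupW F f → Injective _≡_ _≡_ f
  G-injective {f} wf {x} {y} fx≡fy with φ-onto f (f , wf , λ _ → refl)
  ... | d , f≗φd = φ-permutation d (trans (sym (f≗φd x)) (trans fx≡fy (f≗φd y)))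

  φ-involutive : ∀ d → dihMul d d ≡ identity → Involutive _≡_ (φ d)
  φ-involutive d d²≡identity x =
    trans (sym (φ-hom d d x)) (trans (cong (λ e → φ e x) d²≡identity) (φ-identity x))

  φ-commute : ∀ d d′ → dihMul d d′ ≡ dihMul d′ d → Commute (φ d) (φ d′)
  φ-commute d d′ dd′≡d′d x =
    trans (sym (φ-hom d d′ x)) (trans (cong (λ e → φ e x) dd′≡d′d) (φ-hom d′ d x))

  G-involution-or-commute : ∀ {σ τ} → InChainGroupW F σ → InChainGroupW F τ →
    Involutive _≡_ σ ⊎ Involutive _≡_ τ ⊎ Commute σ τ
  G-involution-or-commute {σ} {τ} wσ wτ
    with φ-onto σ (σ , wσ , λ _ → refl) | φ-onto τ (τ , wτ , λ _ → refl)
  ... | d , σ≗φd | d′ , τ≗φd′ with dihedral-dichotomy d d′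
  ... | inj₁ d²≡identity         = inj₁ (Involutive-resp σ≗φd (φ-involutive d d²≡identity))
  ... | inj₂ (inj₁ d′²≡identity) = inj₂ (inj₁ (Involutive-resp τ≗φd′ (φ-involutive d′ d′²≡identity)))
  ... | inj₂ (inj₂ dd′≡d′d)      = inj₂ (inj₂ (Commute-resp σ≗φd τ≗φd′ (φ-commute d d′ dd′≡d′d)))

  open ChainGroupAbelian F G-injective G-involution-or-commute using (abelian)

  dihedral-abelian : ∀ d d′ → dihMul d d′ ≡ dihMul d′ d
  dihedral-abelian d d′ with φ-in-G d | φ-in-G d′
  ... | f , wf , φd≗f | g , wg , φd′≗g = φ-injective _ _ λ x → begin
    φ (dihMul d d′) x ≡⟨ φ-hom d d′ x ⟩
    φ d (φ d′ x)      ≡⟨ Commute-resp φd≗f φd′≗g (abelian wf wg) x ⟩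
    φ d′ (φ d x)      ≡⟨ φ-hom d′ d x ⟨
    φ (dihMul d′ d) x ∎
    where open ≡-Reasoning

-- Small N: a permutation of at most two points is determined by the image
-- of one point, but D_{2N} has more than N elements.

fin2-avoid : {a b c : Fin 2} → a ≢ c → b ≢ c → a ≡ b
fin2-avoid {fzero}      {fzero}      _ _ = refl
fin2-avoid {fsuc fzero} {fsuc fzero} _ _ = refl
fin2-avoid {fzero}      {fsuc fzero} {fzero}      a≢c _ = ⊥-elim (a≢c refl)
fin2-avoid {fzero}      {fsuc fzero} {fsuc fzero} _ b≢c = ⊥-elim (b≢c refl)
fin2-avoid {fsuc fzero} {fzero}      {fzero}      _ b≢c = ⊥-elim (b≢c refl)
fin2-avoid {fsuc fzero} {fzero}      {fsuc fzero} a≢c _ = ⊥-elim (a≢c refl)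

determined-by-zero : ∀ {m} → m ≤ 1 → {f g : Fin (suc m) → Fin (suc m)} →
  Injective _≡_ _≡_ f → Injective _≡_ _≡_ g → f fzero ≡ g fzero → f ≗ g
determined-by-zero _ _ _ f0≡g0 fzero = f0≡g0
determined-by-zero (s≤s z≤n) f-inj g-inj f0≡g0 (fsuc fzero) =
  fin2-avoid (λ f1≡f0 → one≢zero (f-inj f1≡f0)) (λ g1≡f0 → one≢zero (g-inj (trans g1≡f0 f0≡g0)))
  where
  one≢zero : fsuc fzero ≢ fzero {1}
  one≢zero ()

-- N + 1 distinct elements of D_{2N}: the rotations and one reflection.
embed : ∀ {m} → Fin (suc (suc m)) → Dihedral (suc m)
embed fzero    = fzero , true
embed (fsuc i) = i , false

embed-injective : ∀ {m} → Injective _≡_ _≡_ (embed {m})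
embed-injective {x = fzero}  {fzero}  _  = refl
embed-injective {x = fsuc i} {fsuc j} eq = cong fsuc (cong proj₁ eq)
embed-injective {x = fzero}  {fsuc _} ()
embed-injective {x = fsuc _} {fzero}  ()

too-few-permutations : ∀ {m} → m ≤ 1 → (F : Forest (suc m)) → ¬ ChainGroupIsoDihedral F
too-few-permutations {m} m≤1 F (φ , φ-in-G , φ-hom , φ-injective , φ-onto) =
  1+n≰n (injective⇒≤ image-of-zero-injective)
  where
  open Isomorphism F φ φ-in-G φ-hom φ-injective φ-onto using (φ-permutation)

  image-of-zero : Fin (suc (suc m)) → Fin (suc m)
  image-of-zero i = φ (embed i) fzero

  image-of-zero-injective : Injective _≡_ _≡_ image-of-zero
  image-of-zero-injective eq = embed-injective
    (φ-injective _ _ (determined-by-zero m≤1 (φ-permutation _) (φ-permutation _) eq))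

mainTheorem8 : (n : ℕ) → (F : Forest n) → ¬ ChainGroupIsoDihedral F
mainTheorem8 zero F (_ , _ , _ , _ , φ-onto) with φ-onto id (id , one , λ _ → refl)
... | (() , _) , _
mainTheorem8 1 F = too-few-permutations z≤n F
mainTheorem8 2 F = too-few-permutations (s≤s z≤n) F
mainTheorem8 (suc (suc (suc k))) F (φ , φ-in-G , φ-hom , φ-injective , φ-onto) =
  dihedral-nonabelian k (dihedral-abelian (fsuc fzero , false) (fsuc fzero , true))
  where open Isomorphism F φ φ-in-G φ-hom φ-injective φ-onto using (dihedral-abelian)
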